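{- Let $\mathcal{P}$ be a stable partition and let $\mathsf{pred}_{\mathcal{P}}:\mathbb{Z}\to\mathbb{Z}$ be a non-decreasing function with $\mathsf{pred}_{\mathcal{P}}(p_{i+1})=p_i$ for all $i$, and with $\mathsf{pred}_{\mathcal{P}}(I)\le I-1$ and $[\mathsf{pred}_{\mathcal{P}}(I)..I-1]$ a stable segment for all $I$. For integers $I<I'$, let $J=\mathsf{pred}_{\mathcal{P}}(I)$ and $J'=\mathsf{pred}_{\mathcal{P}}(I')$. Then (a) $\mathsf{ed}(X[I..I'-1],Y[J..J'-1])\le\mathsf{sing}_X[I,I')+\mathsf{sing}_Y[J,J')\le\mathsf{sing}[J,I')$; (b) $|(I'-J')-(I-J)|=|(I'-I)-(J'-J)|\le\mathsf{sing}_X[I,I')+\mathsf{sing}_Y[J,J')\le\mathsf{sing}[J,I')$.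
   Context: Setting: $L\ge1$, $X=Y$ is a string of length $L$ over $\Sigma$, and $E_0=\{(i_1,j_1),\dots,(i_M,j_M)\}\subseteq[L]^2$ with $i_t>j_t$, $X[i_t]=Y[j_t]$, $i_1<\dots<i_M$, $j_1<\dots<j_M$. Extend $X,Y$ to $\mathbb{Z}$ by $X[i]=Y[i]=X[L]$ for $i>L$ and $X[i]=Y[i]=X[1]$ for $i<1$; matched edges are $E=E_0\cup\{(i,i-1): i>L\text{ or } i\le1\}$ (non-intersecting, each edge $(I,J)$ has $I>J$). A segment $[l..r]$ is stable if for every $(I,J)\in E$ exactly one holds: ($J<l$ and $I\le r$) or ($J\ge l$ and $I>r$). A stable partition is a partition of $\mathbb{Z}$ into segments $\mathcal{P}_i=[p_i..p_{i+1}-1]$, $p_i<p_{i+1}$, each stable (such functions $\mathsf{pred}_{\mathcal{P}}$ exist for every stable partition). A singleton is a position $i$ of $X$ with no edge $(i,\cdot)\in E$, or a position $j$ of $Y$ with no edge $(\cdot,j)\in E$. $\mathsf{sing}_X[l,r)$ (resp. $\mathsf{sing}_Y[l,r)$) is the number of singletons of $X$ (resp. $Y$) among positions $l,\dots,r-1$, and $\mathsf{sing}[l,r)=\mathsf{sing}_X[l,r)+\mathsf{sing}_Y[l,r)$. $\mathsf{ed}$ is edit distance. -}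

module Defs where

open import Data.Nat as ℕ using (ℕ; zero; suc)
open import Data.Integer as ℤ using (ℤ; +_; -[1+_]; _+_; _-_; _≤_; _<_; _>_; 0ℤ; 1ℤ; -1ℤ; ∣_∣; _⊔_)
import Data.Integer.Properties as ℤP
open import Data.Fin using (Fin)
open import Data.Vec using (Vec; lookup)
open import Data.List using (List; []; _∷_; map; filter; length)
open import Data.List.Membership.Propositional using (_∈_)
open import Data.List.Relation.Unary.Any using (Any; here; there; any?)
open import Data.List.Relation.Unary.All using (All)
open import Data.List.Relation.Unary.Linked using (Linked)
open import Data.Product using (_×_; _,_; proj₁; proj₂; ∃; ∃-syntax)
open import Data.Sum using (_⊎_; inj₁; inj₂)
open import Data.Empty using (⊥; ⊥-elim)
open import Relation.Nullary using (¬_; Dec; yes; no)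
open import Relation.Nullary.Decidable using (_⊎-dec_)
open import Relation.Binary.PropositionalEquality using (_≡_; refl; sym; trans; cong)
open import Relation.Binary.Definitions using (DecidableEquality)

module _ {Σ : Set} (_≟_ : DecidableEquality Σ) where

  subCost : Σ → Σ → ℕ
  subCost a b with a ≟ b
  ... | yes _ = 0
  ... | no _  = 1

  ed : List Σ → List Σ → ℕ
  ed []       ys       = length ys
  ed (x ∷ xs) []       = suc (length xs)
  ed (x ∷ xs) (y ∷ ys) =
    ℕ._⊓_ (suc (ed xs (y ∷ ys)))
      (ℕ._⊓_ (suc (ed (x ∷ xs) ys)) (ed xs ys ℕ.+ subCost x y))

-- Strings indexed by positions 1..L (L = suc n), extended to ℤ by
-- X[i] = X[1] for i < 1 and X[i] = X[L] for i > L.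

clampFin : ℕ → (n : ℕ) → Fin (suc n)
clampFin zero    n       = Fin.zero
clampFin (suc m) zero    = Fin.zero
clampFin (suc m) (suc n) = Fin.suc (clampFin m n)

ext : {Σ : Set} {n : ℕ} → Vec Σ (suc n) → ℤ → Σ
ext {n = n} X (+ zero)  = lookup X Fin.zero
ext {n = n} X (+ suc m) = lookup X (clampFin m n)   -- position m+1
ext {n = n} X -[1+ m ]  = lookup X Fin.zero

range : ℤ → ℕ → List ℤ
range l zero    = []
range l (suc k) = l ∷ range (l + 1ℤ) k

len : ℤ → ℤ → ℕ
len l r = ∣ (r - l) ⊔ 0ℤ ∣

interval : ℤ → ℤ → List ℤ
interval l r = range l (len l r)

substr : {Σ : Set} {n : ℕ} → Vec Σ (suc n) → ℤ → ℤ → List Σ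
substr X l r = map (ext X) (interval l r)

-- The input edge set E₀ (as the list (i₁,j₁),…,(i_M,j_M)) for X = Y.

ValidE0 : {Σ : Set} {n : ℕ} → Vec Σ (suc n) → List (ℤ × ℤ) → Set
ValidE0 {n = n} X E0 =
  All (λ e → (1ℤ ≤ proj₁ e × proj₁ e ≤ + suc n) × (1ℤ ≤ proj₂ e × proj₂ e ≤ + suc n)
             × proj₁ e > proj₂ e × ext X (proj₁ e) ≡ ext X (proj₂ e)) E0
  × Linked (λ e e' → proj₁ e < proj₁ e' × proj₂ e < proj₂ e') E0

Edge : (n : ℕ) → List (ℤ × ℤ) → ℤ → ℤ → Set
Edge n E0 I J = ((I , J) ∈ E0) ⊎ (J ≡ I - 1ℤ × (I > + suc n ⊎ I ≤ 1ℤ))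

Stable : (n : ℕ) → List (ℤ × ℤ) → ℤ → ℤ → Set
Stable n E0 l r = ∀ I J → Edge n E0 I J →
  let A = J < l × I ≤ r
      B = l ≤ J × I > r
  in (A ⊎ B) × ¬ (A × B)

-- p : ℤ → ℤ describes the stable partition {[p i .. p (i+1) - 1] : i ∈ ℤ}
StablePartition : (n : ℕ) → List (ℤ × ℤ) → (ℤ → ℤ) → Set
StablePartition n E0 p =
  (∀ i → p i < p (i + 1ℤ))
  × (∀ x → ∃[ i ] (p i ≤ x × x < p (i + 1ℤ)))
  × (∀ i → Stable n E0 (p i) (p (i + 1ℤ) - 1ℤ))

IsPred : (n : ℕ) → List (ℤ × ℤ) → (ℤ → ℤ) → (ℤ → ℤ) → Set
IsPred n E0 p pr =
  (∀ a b → a ≤ b → pr a ≤ pr b)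
  × (∀ i → pr (p (i + 1ℤ)) ≡ p i)
  × (∀ I → pr I ≤ I - 1ℤ)
  × (∀ I → Stable n E0 (pr I) (I - 1ℤ))

SingX : (n : ℕ) → List (ℤ × ℤ) → ℤ → Set
SingX n E0 i = ∀ J → ¬ Edge n E0 i J

SingY : (n : ℕ) → List (ℤ × ℤ) → ℤ → Set
SingY n E0 j = ∀ I → ¬ Edge n E0 I j

private
  fstAny : ∀ {i} (E0 : List (ℤ × ℤ)) → Any (λ e → proj₁ e ≡ i) E0 → ∃[ J ] ((i , J) ∈ E0)
  fstAny ((a , b) ∷ E0) (here refl) = b , here refl
  fstAny (_ ∷ E0) (there p) with fstAny E0 p
  ... | J , m = J , there m

  sndAny : ∀ {j} (E0 : List (ℤ × ℤ)) → Any (λ e → proj₂ e ≡ j) E0 → ∃[ I ] ((I , j) ∈ E0)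
  sndAny ((a , b) ∷ E0) (here refl) = a , here refl
  sndAny (_ ∷ E0) (there p) with sndAny E0 p
  ... | I , m = I , there m

  memFst : ∀ {i J} {E0 : List (ℤ × ℤ)} → (i , J) ∈ E0 → Any (λ e → proj₁ e ≡ i) E0
  memFst (here refl) = here refl
  memFst (there m)   = there (memFst m)

  memSnd : ∀ {I j} {E0 : List (ℤ × ℤ)} → (I , j) ∈ E0 → Any (λ e → proj₂ e ≡ j) E0
  memSnd (here refl) = here refl
  memSnd (there m)   = there (memSnd m)

  +1-1 : ∀ j → j ≡ (j + 1ℤ) - 1ℤ
  +1-1 j = sym (trans (ℤP.+-assoc j 1ℤ -1ℤ) (ℤP.+-identityʳ j))

  -1+1 : ∀ I → (I - 1ℤ) + 1ℤ ≡ I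
  -1+1 I = trans (ℤP.+-assoc I -1ℤ 1ℤ) (ℤP.+-identityʳ I)

singX? : (n : ℕ) (E0 : List (ℤ × ℤ)) (i : ℤ) → Dec (SingX n E0 i)
singX? n E0 i with any? (λ e → proj₁ e ℤ.≟ i) E0
... | yes a = no (λ s → let (J , m) = fstAny E0 a in s J (inj₁ m))
... | no ¬a with (+ suc n ℤP.<? i) ⊎-dec (i ℤP.≤? 1ℤ)
...   | yes c = no (λ s → s (i - 1ℤ) (inj₂ (refl , c)))
...   | no ¬c = yes λ { J (inj₁ m) → ¬a (memFst m) ; J (inj₂ (_ , c)) → ¬c c }

singY? : (n : ℕ) (E0 : List (ℤ × ℤ)) (j : ℤ) → Dec (SingY n E0 j)
singY? n E0 j with any? (λ e → proj₂ e ℤ.≟ j) E0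
... | yes a = no (λ s → let (I , m) = sndAny E0 a in s I (inj₁ m))
... | no ¬a with (+ suc n ℤP.<? (j + 1ℤ)) ⊎-dec ((j + 1ℤ) ℤP.≤? 1ℤ)
...   | yes c = no (λ s → s (j + 1ℤ) (inj₂ (+1-1 j , c)))
...   | no ¬c = yes λ { I (inj₁ m) → ¬a (memSnd m)
                      ; I (inj₂ (refl , c)) → ¬c (subst' c) }
  where
  subst' : ∀ {I} → (I > + suc n ⊎ I ≤ 1ℤ) → ((I - 1ℤ) + 1ℤ > + suc n ⊎ (I - 1ℤ) + 1ℤ ≤ 1ℤ)
  subst' {I} c rewrite -1+1 I = c

singXc : (n : ℕ) → List (ℤ × ℤ) → ℤ → ℤ → ℕ
singXc n E0 l r = length (filter (singX? n E0) (interval l r))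

singYc : (n : ℕ) → List (ℤ × ℤ) → ℤ → ℤ → ℕ
singYc n E0 l r = length (filter (singY? n E0) (interval l r))

singc : (n : ℕ) → List (ℤ × ℤ) → ℤ → ℤ → ℕ
singc n E0 l r = singXc n E0 l r ℕ.+ singYc n E0 l r

module Submission where

-- Stability of [J..I-1] and [J'..I'-1] says that the edges of E leaving X[I..I') are
-- exactly those entering Y[J..J'). As E is non-crossing and joins equal letters, they form a
-- monotone matching between the two windows; aligning along it edits only singletons, and
-- each window has length (number of edges) + (its singletons), whence both bounds. The last
-- inequality holds because [I, I') and [J, J') are subintervals of [J, I').

open import Defs
open import Data.Nat as ℕ using (ℕ; zero; suc; s≤s)
import Data.Nat.Properties as ℕP
open import Data.Integer as ℤ
  using (ℤ; +_; _+_; _-_; _≤_; _<_; _>_; 1ℤ; -1ℤ; ∣_∣; pred; +≤+)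
import Data.Integer.Properties as ℤP
open import Data.Integer.Tactic.RingSolver using (solve-∀)
open import Data.Fin as Fin using (fromℕ)
open import Data.Vec using (Vec; lookup)
open import Data.List using (List; []; _∷_; map; filter; length; _++_)
import Data.List.Properties as ListP
open import Data.List.Membership.Propositional using (_∈_; find; lose)
open import Data.List.Membership.Propositional.Properties using (∈-AllPairs₂)
open import Data.List.Relation.Unary.Any using (here; there; any?)
import Data.List.Relation.Unary.All as All
open import Data.List.Relation.Unary.Linked.Properties using (Linked⇒AllPairs)
open import Data.Product using (_×_; _,_; proj₁; proj₂; ∃)
open import Data.Sum using (_⊎_; inj₁; inj₂; [_,_]′; swap)
open import Data.Empty using (⊥-elim)
open import Relation.Nullary using (¬_; yes; no)
open import Relation.Nullary.Decidable using (_⊎-dec_)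
open import Relation.Unary using (Pred; Decidable)
open import Relation.Binary using (tri<; tri≈; tri>)
open import Relation.Binary.Definitions using (DecidableEquality)
open import Relation.Binary.PropositionalEquality
  using (_≡_; refl; sym; trans; cong; cong₂; subst; module ≡-Reasoning)

i-1≡pred[i] : ∀ i → i - 1ℤ ≡ pred i
i-1≡pred[i] i = ℤP.+-comm i -1ℤ

≤i-1⇒< : ∀ {x} i → x ≤ i - 1ℤ → x < i
≤i-1⇒< {x} i p = ℤP.i≤pred[j]⇒i<j (subst (x ≤_) (i-1≡pred[i] i) p)

<⇒≤i-1 : ∀ {x i} → x < i → x ≤ i - 1ℤ
<⇒≤i-1 {x} {i} p = subst (x ≤_) (sym (i-1≡pred[i] i)) (ℤP.i<j⇒i≤pred[j] p)

i-1+1≡i : ∀ i → (i - 1ℤ) + 1ℤ ≡ i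
i-1+1≡i = solve-∀

i+1-1≡i : ∀ i → (i + 1ℤ) - 1ℤ ≡ i
i+1-1≡i = solve-∀

i-1<i : ∀ i → i - 1ℤ < i
i-1<i i = ≤i-1⇒< i ℤP.≤-refl

<⇒i+1≤ : ∀ {i j} → i < j → i + 1ℤ ≤ j
<⇒i+1≤ {i} p = subst (_≤ _) (ℤP.+-comm 1ℤ i) (ℤP.i<j⇒suc[i]≤j p)

i+1≤⇒< : ∀ {i j} → i + 1ℤ ≤ j → i < j
i+1≤⇒< {i} p = ℤP.suc[i]≤j⇒i<j (subst (_≤ _) (ℤP.+-comm i 1ℤ) p)

i-1<⇒≤ : ∀ {x} i → i - 1ℤ < x → i ≤ x
i-1<⇒≤ {x} i p = subst (_≤ x) (i-1+1≡i i) (<⇒i+1≤ p)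

∈-range⁻ : ∀ {x} l k → x ∈ range l k → l ≤ x × x < l + + k
∈-range⁻ l (suc k) (here refl) =
  ℤP.≤-refl , subst (l <_) (ℤP.+-assoc l 1ℤ (+ k)) (i+1≤⇒< (ℤP.i≤i+j (l + 1ℤ) (+ k)))
∈-range⁻ {x} l (suc k) (there x∈) with ∈-range⁻ (l + 1ℤ) k x∈
... | l+1≤x , x<end = ℤP.<⇒≤ (i+1≤⇒< l+1≤x) , subst (x <_) (ℤP.+-assoc l 1ℤ (+ k)) x<end

∈-range⁺ : ∀ {x} l k → l ≤ x → x < l + + k → x ∈ range l k
∈-range⁺ {x} l zero l≤x x<l =
  ⊥-elim (ℤP.<⇒≱ x<l (subst (_≤ x) (sym (ℤP.+-identityʳ l)) l≤x))
∈-range⁺ {x} l (suc k) l≤x x<end with x ℤ.≟ l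
... | yes refl = here refl
... | no x≢l = there (∈-range⁺ (l + 1ℤ) k (<⇒i+1≤ (ℤP.≤∧≢⇒< l≤x (λ e → x≢l (sym e))))
                        (subst (x <_) (sym (ℤP.+-assoc l 1ℤ (+ k))) x<end))

∉-range-zero : ∀ {x l} → ¬ x ∈ range l 0
∉-range-zero ()

∈-range-tail⇒< : ∀ {x} l k → x ∈ range (l + 1ℤ) k → l < x
∈-range-tail⇒< l k x∈ = i+1≤⇒< (proj₁ (∈-range⁻ (l + 1ℤ) k x∈))

range-++ : ∀ l a b → range l (a ℕ.+ b) ≡ range l a ++ range (l + + a) b
range-++ l zero b = cong (λ z → range z b) (sym (ℤP.+-identityʳ l))
range-++ l (suc a) b = cong (l ∷_) (trans (range-++ (l + 1ℤ) a b)
  (cong (λ z → range (l + 1ℤ) a ++ range z b) (ℤP.+-assoc l 1ℤ (+ a))))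

+len≡ : ∀ {l r} → l ≤ r → + len l r ≡ r - l
+len≡ l≤r = trans (cong (λ z → + ∣ z ∣) (ℤP.i≥j⇒i⊔j≡i 0≤r-l)) (ℤP.0≤i⇒+∣i∣≡i 0≤r-l)
  where 0≤r-l = ℤP.i≤j⇒0≤j-i l≤r

l+len≡r : ∀ {l r} → l ≤ r → l + + len l r ≡ r
l+len≡r {l} {r} l≤r = trans (cong (λ z → l + z) (+len≡ l≤r)) (l+[r-l]≡r l r)
  where
  l+[r-l]≡r : ∀ l r → l + (r - l) ≡ r
  l+[r-l]≡r = solve-∀

len-split : ∀ {l m r} → l ≤ m → m ≤ r → len l r ≡ len l m ℕ.+ len m r
len-split {l} {m} {r} l≤m m≤r = ℤP.+-injective (begin
  + len l r                    ≡⟨ +len≡ (ℤP.≤-trans l≤m m≤r) ⟩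
  r - l                        ≡⟨ telescope l m r ⟩
  (m - l) + (r - m)            ≡⟨ sym (cong₂ _+_ (+len≡ l≤m) (+len≡ m≤r)) ⟩
  + len l m + + len m r        ∎)
  where
  open ≡-Reasoning
  telescope : ∀ l m r → r - l ≡ (m - l) + (r - m)
  telescope = solve-∀

len≡0 : ∀ {l r} → r ≤ l → len l r ≡ 0
len≡0 r≤l = cong ∣_∣ (ℤP.i≤j⇒i⊔j≡j (ℤP.i≤j⇒i-j≤0 r≤l))

∈-interval⁻ : ∀ {x} l r → x ∈ interval l r → l ≤ x × x < r
∈-interval⁻ {x} l r x∈ with l ℤP.≤? r
... | yes l≤r = subst (λ z → l ≤ x × x < z) (l+len≡r l≤r) (∈-range⁻ l (len l r) x∈)
... | no l≰r =
  ⊥-elim (∉-range-zero {l = l} (subst (λ k → x ∈ range l k) (len≡0 (ℤP.<⇒≤ (ℤP.≰⇒> l≰r))) x∈))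

∈-interval⁺ : ∀ {x l r} → l ≤ x → x < r → x ∈ interval l r
∈-interval⁺ {x} {l} {r} l≤x x<r =
  ∈-range⁺ l (len l r) l≤x (subst (x <_) (sym (l+len≡r (ℤP.<⇒≤ (ℤP.≤-<-trans l≤x x<r)))) x<r)

module _ {p} {P : Pred ℤ p} (P? : Decidable P) where

  count : ℤ → ℕ → ℕ
  count a k = length (filter P? (range a k))

  count-accept : ∀ {a k} → P a → count a (suc k) ≡ suc (count (a + 1ℤ) k)
  count-accept Pa = cong length (ListP.filter-accept P? Pa)

  count-reject : ∀ {a k} → ¬ P a → count a (suc k) ≡ count (a + 1ℤ) k
  count-reject ¬Pa = cong length (ListP.filter-reject P? ¬Pa)

  count-++ : ∀ l a b → count l (a ℕ.+ b) ≡ count l a ℕ.+ count (l + + a) b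
  count-++ l a b = begin
    length (filter P? (range l (a ℕ.+ b)))
      ≡⟨ cong (λ xs → length (filter P? xs)) (range-++ l a b) ⟩
    length (filter P? (range l a ++ range (l + + a) b))
      ≡⟨ cong length (ListP.filter-++ P? (range l a) (range (l + + a) b)) ⟩
    length (filter P? (range l a) ++ filter P? (range (l + + a) b))
      ≡⟨ ListP.length-++ (filter P? (range l a)) ⟩
    count l a ℕ.+ count (l + + a) b ∎
    where open ≡-Reasoning

  count-interval-split : ∀ {l m r} → l ≤ m → m ≤ r →
    count l (len l r) ≡ count l (len l m) ℕ.+ count m (len m r)
  count-interval-split {l} {m} {r} l≤m m≤r = begin
    count l (len l r)                                  ≡⟨ cong (count l) (len-split l≤m m≤r) ⟩
    count l (len l m ℕ.+ len m r)                      ≡⟨ count-++ l (len l m) (len m r) ⟩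
    count l (len l m) ℕ.+ count (l + + len l m) (len m r)
                                                       ≡⟨ cong (λ z → count l (len l m) ℕ.+ count z (len m r)) (l+len≡r l≤m) ⟩
    count l (len l m) ℕ.+ count m (len m r)            ∎
    where open ≡-Reasoning

  count-interval-mono : ∀ {l l' r' r} → l ≤ l' → l' ≤ r' → r' ≤ r →
    count l' (len l' r') ℕ.≤ count l (len l r)
  count-interval-mono {l} {l'} {r'} {r} l≤l' l'≤r' r'≤r = begin
    count l' (len l' r')                                            ≤⟨ ℕP.m≤m+n _ _ ⟩
    count l' (len l' r') ℕ.+ count r' (len r' r)                    ≡⟨ sym (count-interval-split l'≤r' r'≤r) ⟩
    count l' (len l' r)                                             ≤⟨ ℕP.m≤n+m _ _ ⟩
    count l (len l l') ℕ.+ count l' (len l' r)                      ≡⟨ sym (count-interval-split l≤l' (ℤP.≤-trans l'≤r' r'≤r)) ⟩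
    count l (len l r)                                               ∎
    where open ℕP.≤-Reasoning

module _ {Σ : Set} (_≟_ : DecidableEquality Σ) where

  ed-[]ʳ : ∀ xs → ed _≟_ xs [] ≡ length xs
  ed-[]ʳ []      = refl
  ed-[]ʳ (_ ∷ _) = refl

  ed-deleteˡ : ∀ x xs ys → ed _≟_ (x ∷ xs) ys ℕ.≤ suc (ed _≟_ xs ys)
  ed-deleteˡ x xs []       = ℕP.≤-reflexive (cong suc (sym (ed-[]ʳ xs)))
  ed-deleteˡ x xs (y ∷ ys) = ℕP.m⊓n≤m _ _

  ed-insertʳ : ∀ xs y ys → ed _≟_ xs (y ∷ ys) ℕ.≤ suc (ed _≟_ xs ys)
  ed-insertʳ []       y ys = ℕP.≤-refl
  ed-insertʳ (x ∷ xs) y ys = ℕP.≤-trans (ℕP.m⊓n≤n _ _) (ℕP.m⊓n≤m _ _)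

  subCost-refl : ∀ x → subCost _≟_ x x ≡ 0
  subCost-refl x with x ≟ x
  ... | yes _  = refl
  ... | no x≢x = ⊥-elim (x≢x refl)

  ed-match : ∀ {x y} xs ys → x ≡ y → ed _≟_ (x ∷ xs) (y ∷ ys) ℕ.≤ ed _≟_ xs ys
  ed-match {x} xs ys refl = begin
    ed _≟_ (x ∷ xs) (x ∷ ys)            ≤⟨ ℕP.≤-trans (ℕP.m⊓n≤n _ _) (ℕP.m⊓n≤n _ _) ⟩
    ed _≟_ xs ys ℕ.+ subCost _≟_ x x    ≡⟨ cong (ed _≟_ xs ys ℕ.+_) (subCost-refl x) ⟩
    ed _≟_ xs ys ℕ.+ 0                  ≡⟨ ℕP.+-identityʳ _ ⟩
    ed _≟_ xs ys                        ∎
    where open ℕP.≤-Reasoning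

Before : ℤ × ℤ → ℤ × ℤ → Set
Before e e' = proj₁ e < proj₁ e' × proj₂ e < proj₂ e'

Before-trans : ∀ {e e' e''} → Before e e' → Before e' e'' → Before e e''
Before-trans (x<x' , y<y') (x'<x'' , y'<y'') = ℤP.<-trans x<x' x'<x'' , ℤP.<-trans y<y' y'<y''

NonCrossing : (ℤ → ℤ → Set) → Set
NonCrossing E = ∀ {x y x' y'} → E x y → E x' y' →
  (x , y) ≡ (x' , y') ⊎ Before (x , y) (x' , y') ⊎ Before (x' , y') (x , y)

Unmatchedˡ : (ℤ → ℤ → Set) → ℤ → Set
Unmatchedˡ E x = ∀ y → ¬ E x y

Unmatchedʳ : (ℤ → ℤ → Set) → ℤ → Set
Unmatchedʳ E y = ∀ x → ¬ E x y

weaklyCrossing⇒≡ : ∀ {E} → NonCrossing E → ∀ {x y x' y'} → E x y → E x' y' →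
  x ≤ x' → y' ≤ y → (x , y) ≡ (x' , y')
weaklyCrossing⇒≡ nonCrossing e e' x≤x' y'≤y with nonCrossing e e'
... | inj₁ eq                  = eq
... | inj₂ (inj₁ (_ , y<y'))   = ⊥-elim (ℤP.<⇒≱ y<y' y'≤y)
... | inj₂ (inj₂ (x'<x , _))   = ⊥-elim (ℤP.<⇒≱ x'<x x≤x')

record Closed (E : ℤ → ℤ → Set) (a : ℤ) (k : ℕ) (c : ℤ) (m : ℕ) : Set where
  field
    forth : ∀ {x y} → E x y → x ∈ range a k → y ∈ range c m
    back  : ∀ {x y} → E x y → y ∈ range c m → x ∈ range a k

-- Windows u[a, a+k) and v[c, c+m) that no edge leaves can be aligned along
-- the edges: matched pairs cost nothing, each unmatched position costs one.
module Alignment {Σ : Set} (_≟_ : DecidableEquality Σ) (u v : ℤ → Σ)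
  (E : ℤ → ℤ → Set) (nonCrossing : NonCrossing E)
  (sameLetter : ∀ {x y} → E x y → u x ≡ v y)
  (matchˡ? : ∀ x → Unmatchedˡ E x ⊎ ∃ (E x))
  (matchʳ? : ∀ y → Unmatchedʳ E y ⊎ ∃ λ x → E x y)
  (unmatchedˡ? : Decidable (Unmatchedˡ E)) (unmatchedʳ? : Decidable (Unmatchedʳ E))
  where

  open Closed

  record Aligned (a : ℤ) (k : ℕ) (c : ℤ) (m : ℕ) : Set where
    field
      ed≤     : ed _≟_ (map u (range a k)) (map v (range c m))
                  ℕ.≤ count unmatchedˡ? a k ℕ.+ count unmatchedʳ? c m
      matched : ℕ
      lengthˡ : k ≡ matched ℕ.+ count unmatchedˡ? a k
      lengthʳ : m ≡ matched ℕ.+ count unmatchedʳ? c m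

  closed-skipˡ : ∀ {a k c m} → Unmatchedˡ E a → Closed E a (suc k) c m → Closed E (a + 1ℤ) k c m
  forth (closed-skipˡ un cl) e x∈ = forth cl e (there x∈)
  back  (closed-skipˡ un cl) {y = y} e y∈ with back cl e y∈
  ... | here refl = ⊥-elim (un y e)
  ... | there x∈  = x∈

  closed-skipʳ : ∀ {a k c m} → Unmatchedʳ E c → Closed E a k c (suc m) → Closed E a k (c + 1ℤ) m
  forth (closed-skipʳ un cl) {x} e x∈ with forth cl e x∈
  ... | here refl = ⊥-elim (un x e)
  ... | there y∈  = y∈
  back  (closed-skipʳ un cl) e y∈ = back cl e (there y∈)

  closed-match : ∀ {a k c m} → E a c → Closed E a (suc k) c (suc m) → Closed E (a + 1ℤ) k (c + 1ℤ) m
  forth (closed-match {a} {k} eac cl) e x∈ with forth cl e (there x∈)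
  ... | here refl =
    ⊥-elim (ℤP.<-irrefl (cong proj₁ (weaklyCrossing⇒≡ nonCrossing eac e
              (ℤP.<⇒≤ (∈-range-tail⇒< a k x∈)) ℤP.≤-refl)) (∈-range-tail⇒< a k x∈))
  ... | there y∈  = y∈
  back  (closed-match {c = c} {m} eac cl) e y∈ with back cl e (there y∈)
  ... | here refl =
    ⊥-elim (ℤP.<-irrefl (sym (cong proj₂ (weaklyCrossing⇒≡ nonCrossing e eac
              ℤP.≤-refl (ℤP.<⇒≤ (∈-range-tail⇒< c m y∈))))) (∈-range-tail⇒< c m y∈))
  ... | there x∈  = x∈

  -- The partners of the two first positions cannot cross, so they are each other.
  closed-head-edge : ∀ {a k c m x y} → Closed E a (suc k) c (suc m) → E a y → E x c → E a c
  closed-head-edge {a} {k} {c} {m} cl ea ec =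
    subst (E a) (cong proj₂ (weaklyCrossing⇒≡ nonCrossing ea ec
      (proj₁ (∈-range⁻ a (suc k) (back cl ec (here refl))))
      (proj₁ (∈-range⁻ c (suc m) (forth cl ea (here refl))))))
    ea

  aligned-[] : ∀ {a c} → Aligned a 0 c 0
  aligned-[] = record { ed≤ = ℕP.≤-refl ; matched = 0 ; lengthˡ = refl ; lengthʳ = refl }

  aligned-skipˡ : ∀ {a k c m} → Unmatchedˡ E a → Aligned (a + 1ℤ) k c m → Aligned a (suc k) c m
  aligned-skipˡ {a} {k} {c} {m} un al = record
    { ed≤     = begin
        ed _≟_ (u a ∷ xs) ys        ≤⟨ ed-deleteˡ _≟_ (u a) xs ys ⟩
        suc (ed _≟_ xs ys)          ≤⟨ s≤s ed≤ ⟩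
        suc (sˡ ℕ.+ sʳ)             ≡⟨ cong (ℕ._+ sʳ) (sym (count-accept unmatchedˡ? un)) ⟩
        count unmatchedˡ? a (suc k) ℕ.+ sʳ ∎
    ; matched = matched
    ; lengthˡ = trans (cong suc lengthˡ)
                  (trans (sym (ℕP.+-suc matched sˡ))
                    (cong (matched ℕ.+_) (sym (count-accept unmatchedˡ? un))))
    ; lengthʳ = lengthʳ
    }
    where
    open Aligned al
    open ℕP.≤-Reasoning
    xs = map u (range (a + 1ℤ) k)
    ys = map v (range c m)
    sˡ = count unmatchedˡ? (a + 1ℤ) k
    sʳ = count unmatchedʳ? c m

  aligned-skipʳ : ∀ {a k c m} → Unmatchedʳ E c → Aligned a k (c + 1ℤ) m → Aligned a k c (suc m)
  aligned-skipʳ {a} {k} {c} {m} un al = record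
    { ed≤     = begin
        ed _≟_ xs (v c ∷ ys)        ≤⟨ ed-insertʳ _≟_ xs (v c) ys ⟩
        suc (ed _≟_ xs ys)          ≤⟨ s≤s ed≤ ⟩
        suc (sˡ ℕ.+ sʳ)             ≡⟨ sym (ℕP.+-suc sˡ sʳ) ⟩
        sˡ ℕ.+ suc sʳ               ≡⟨ cong (sˡ ℕ.+_) (sym (count-accept unmatchedʳ? un)) ⟩
        sˡ ℕ.+ count unmatchedʳ? c (suc m) ∎
    ; matched = matched
    ; lengthˡ = lengthˡ
    ; lengthʳ = trans (cong suc lengthʳ)
                  (trans (sym (ℕP.+-suc matched sʳ))
                    (cong (matched ℕ.+_) (sym (count-accept unmatchedʳ? un))))
    }
    where
    open Aligned al
    open ℕP.≤-Reasoning
    xs = map u (range a k)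
    ys = map v (range (c + 1ℤ) m)
    sˡ = count unmatchedˡ? a k
    sʳ = count unmatchedʳ? (c + 1ℤ) m

  aligned-match : ∀ {a k c m} → E a c → Aligned (a + 1ℤ) k (c + 1ℤ) m → Aligned a (suc k) c (suc m)
  aligned-match {a} {k} {c} {m} eac al = record
    { ed≤     = begin
        ed _≟_ (u a ∷ xs) (v c ∷ ys)  ≤⟨ ed-match _≟_ xs ys (sameLetter eac) ⟩
        ed _≟_ xs ys                  ≤⟨ ed≤ ⟩
        sˡ ℕ.+ sʳ                     ≡⟨ sym (cong₂ ℕ._+_ countˡ countʳ) ⟩
        count unmatchedˡ? a (suc k) ℕ.+ count unmatchedʳ? c (suc m) ∎
    ; matched = suc matched
    ; lengthˡ = cong suc (trans lengthˡ (cong (matched ℕ.+_) (sym countˡ)))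
    ; lengthʳ = cong suc (trans lengthʳ (cong (matched ℕ.+_) (sym countʳ)))
    }
    where
    open Aligned al
    open ℕP.≤-Reasoning
    xs = map u (range (a + 1ℤ) k)
    ys = map v (range (c + 1ℤ) m)
    sˡ = count unmatchedˡ? (a + 1ℤ) k
    sʳ = count unmatchedʳ? (c + 1ℤ) m
    countˡ : count unmatchedˡ? a (suc k) ≡ sˡ
    countˡ = count-reject unmatchedˡ? (λ un → un c eac)
    countʳ : count unmatchedʳ? c (suc m) ≡ sʳ
    countʳ = count-reject unmatchedʳ? (λ un → un a eac)

  -- Eliminators instead of `with`, so that the termination checker sees the descent in (k, m).
  aligned : ∀ k m a c → Closed E a k c m → Aligned a k c m
  aligned zero zero a c _ = aligned-[]
  aligned zero (suc m) a c cl =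
    [ (λ un → aligned-skipʳ un (aligned zero m a (c + 1ℤ) (closed-skipʳ un cl)))
    , (λ (_ , e) → ⊥-elim (∉-range-zero {l = a} (back cl e (here refl))))
    ]′ (matchʳ? c)
  aligned (suc k) zero a c cl =
    [ (λ un → aligned-skipˡ un (aligned k zero (a + 1ℤ) c (closed-skipˡ un cl)))
    , (λ (_ , e) → ⊥-elim (∉-range-zero {l = c} (forth cl e (here refl))))
    ]′ (matchˡ? a)
  aligned (suc k) (suc m) a c cl =
    [ (λ un → aligned-skipˡ un (aligned k (suc m) (a + 1ℤ) c (closed-skipˡ un cl)))
    , (λ (_ , ea) →
        [ (λ un → aligned-skipʳ un (aligned (suc k) m a (c + 1ℤ) (closed-skipʳ un cl)))
        , (λ (_ , ec) → let eac = closed-head-edge cl ea ec in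
            aligned-match eac (aligned k m (a + 1ℤ) (c + 1ℤ) (closed-match eac cl)))
        ]′ (matchʳ? c))
    ]′ (matchˡ? a)

clampFin-last : ∀ m n → n ℕ.≤ m → clampFin m n ≡ fromℕ n
clampFin-last zero    zero    _         = refl
clampFin-last (suc m) zero    _         = refl
clampFin-last (suc m) (suc n) (s≤s n≤m) = cong Fin.suc (clampFin-last m n n≤m)

module _ {Σ : Set} {n : ℕ} (X : Vec Σ (suc n)) where

  ext-beyond-end : ∀ i → + suc n ≤ i → ext X i ≡ lookup X (fromℕ n)
  ext-beyond-end (+ suc m) (+≤+ (s≤s n≤m)) = cong (lookup X) (clampFin-last m n n≤m)

  ext-before-start : ∀ i → i ≤ 1ℤ → ext X i ≡ lookup X Fin.zero
  ext-before-start (+ zero)          _                = refl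
  ext-before-start (+ suc zero)      _                = refl
  ext-before-start (+ suc (suc m))   (+≤+ (s≤s ()))
  ext-before-start ℤ.-[1+ m ]        _                = refl

module _ {Σ : Set} {n : ℕ} {X : Vec Σ (suc n)} {E0 : List (ℤ × ℤ)} (valid : ValidE0 X E0) where

  -- Every edge of E₀ lies in [1, L]², strictly between the boundary edges.
  boundary-vs-E0 : ∀ {x y i} → (x , y) ∈ E0 → (i > + suc n ⊎ i ≤ 1ℤ) →
    Before (x , y) (i , i - 1ℤ) ⊎ Before (i , i - 1ℤ) (x , y)
  boundary-vs-E0 x∈ (inj₁ L<i) with All.lookup (proj₁ valid) x∈
  ... | (_ , x≤L) , _ , y<x , _ =
    inj₁ (ℤP.≤-<-trans x≤L L<i , ℤP.<-≤-trans y<x (ℤP.≤-trans x≤L (<⇒≤i-1 L<i)))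
  boundary-vs-E0 {i = i} x∈ (inj₂ i≤1) with All.lookup (proj₁ valid) x∈
  ... | _ , (1≤y , _) , y<x , _ =
    inj₂ (ℤP.≤-<-trans i≤1 (ℤP.≤-<-trans 1≤y y<x) , ℤP.<-≤-trans (i-1<i i) (ℤP.≤-trans i≤1 1≤y))

  Edge-nonCrossing : NonCrossing (Edge n E0)
  Edge-nonCrossing (inj₁ e∈) (inj₁ e'∈) = ∈-AllPairs₂ (Linked⇒AllPairs Before-trans (proj₂ valid)) e∈ e'∈
  Edge-nonCrossing (inj₁ e∈) (inj₂ (refl , b)) = inj₂ (boundary-vs-E0 e∈ b)
  Edge-nonCrossing (inj₂ (refl , b)) (inj₁ e∈) = inj₂ (swap (boundary-vs-E0 e∈ b))
  Edge-nonCrossing {x} {_} {x'} (inj₂ (refl , _)) (inj₂ (refl , _)) with ℤP.<-cmp x x'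
  ... | tri< x<x' _ _ = inj₂ (inj₁ (x<x' , ℤP.+-monoˡ-< -1ℤ x<x'))
  ... | tri≈ _ refl _ = inj₁ refl
  ... | tri> _ _ x'<x = inj₂ (inj₂ (x'<x , ℤP.+-monoˡ-< -1ℤ x'<x))

  Edge-sameLetter : ∀ {x y} → Edge n E0 x y → ext X x ≡ ext X y
  Edge-sameLetter (inj₁ e∈) = proj₂ (proj₂ (proj₂ (All.lookup (proj₁ valid) e∈)))
  Edge-sameLetter {x} (inj₂ (refl , inj₁ L<x)) =
    trans (ext-beyond-end X x (ℤP.<⇒≤ L<x)) (sym (ext-beyond-end X (x - 1ℤ) (<⇒≤i-1 L<x)))
  Edge-sameLetter {x} (inj₂ (refl , inj₂ x≤1)) =
    trans (ext-before-start X x x≤1)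
      (sym (ext-before-start X (x - 1ℤ) (ℤP.≤-trans (ℤP.<⇒≤ (i-1<i x)) x≤1)))

Edge-matchˡ? : ∀ n E0 x → Unmatchedˡ (Edge n E0) x ⊎ ∃ (Edge n E0 x)
Edge-matchˡ? n E0 x with any? (λ e → proj₁ e ℤ.≟ x) E0
... | yes found with find found
...   | (_ , y) , e∈ , refl = inj₂ (y , inj₁ e∈)
Edge-matchˡ? n E0 x | no none with (+ suc n ℤP.<? x) ⊎-dec (x ℤP.≤? 1ℤ)
...   | yes boundary = inj₂ (x - 1ℤ , inj₂ (refl , boundary))
...   | no ¬boundary = inj₁ λ where
  y (inj₁ e∈)      → none (lose e∈ refl)
  y (inj₂ (_ , b)) → ¬boundary b

Edge-matchʳ? : ∀ n E0 y → Unmatchedʳ (Edge n E0) y ⊎ ∃ λ x → Edge n E0 x y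
Edge-matchʳ? n E0 y with any? (λ e → proj₂ e ℤ.≟ y) E0
... | yes found with find found
...   | (x , _) , e∈ , refl = inj₂ (x , inj₁ e∈)
Edge-matchʳ? n E0 y | no none with (+ suc n ℤP.<? (y + 1ℤ)) ⊎-dec ((y + 1ℤ) ℤP.≤? 1ℤ)
...   | yes boundary = inj₂ (y + 1ℤ , inj₂ (sym (i+1-1≡i y) , boundary))
...   | no ¬boundary = inj₁ λ where
  x (inj₁ e∈)         → none (lose e∈ refl)
  x (inj₂ (refl , b)) → ¬boundary (subst (λ z → z > + suc n ⊎ z ≤ 1ℤ) (sym (i-1+1≡i x)) b)

module _ {n : ℕ} {E0 : List (ℤ × ℤ)} {l r : ℤ} (stable : Stable n E0 l r) where

  stable-r<x⇒l≤y : ∀ {x y} → Edge n E0 x y → r < x → l ≤ y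
  stable-r<x⇒l≤y e r<x with proj₁ (stable _ _ e)
  ... | inj₁ (_ , x≤r) = ⊥-elim (ℤP.<⇒≱ r<x x≤r)
  ... | inj₂ (l≤y , _) = l≤y

  stable-x≤r⇒y<l : ∀ {x y} → Edge n E0 x y → x ≤ r → y < l
  stable-x≤r⇒y<l e x≤r with proj₁ (stable _ _ e)
  ... | inj₁ (y<l , _) = y<l
  ... | inj₂ (_ , r<x) = ⊥-elim (ℤP.<⇒≱ r<x x≤r)

  stable-l≤y⇒r<x : ∀ {x y} → Edge n E0 x y → l ≤ y → r < x
  stable-l≤y⇒r<x e l≤y with proj₁ (stable _ _ e)
  ... | inj₁ (y<l , _) = ⊥-elim (ℤP.<⇒≱ y<l l≤y)
  ... | inj₂ (_ , r<x) = r<x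

  stable-y<l⇒x≤r : ∀ {x y} → Edge n E0 x y → y < l → x ≤ r
  stable-y<l⇒x≤r e y<l with proj₁ (stable _ _ e)
  ... | inj₁ (_ , x≤r) = x≤r
  ... | inj₂ (l≤y , _) = ⊥-elim (ℤP.<⇒≱ y<l l≤y)

stable-windows-closed : ∀ {n E0 J J'} I I' →
  Stable n E0 J (I - 1ℤ) → Stable n E0 J' (I' - 1ℤ) → Closed (Edge n E0) I (len I I') J (len J J')
Closed.forth (stable-windows-closed I I' st st') e x∈ =
  let I≤x , x<I' = ∈-interval⁻ I I' x∈
  in ∈-interval⁺ (stable-r<x⇒l≤y st e (ℤP.<-≤-trans (i-1<i _) I≤x))
                 (stable-x≤r⇒y<l st' e (<⇒≤i-1 x<I'))
Closed.back (stable-windows-closed I I' st st') e y∈ =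
  let J≤y , y<J' = ∈-interval⁻ _ _ y∈
  in ∈-interval⁺ (i-1<⇒≤ I (stable-l≤y⇒r<x st e J≤y))
                 (≤i-1⇒< I' (stable-y<l⇒x≤r st' e y<J'))

∣k-m∣≤a+b : ∀ {k m} t a b → k ≡ t ℕ.+ a → m ≡ t ℕ.+ b → ∣ + k - + m ∣ ℕ.≤ a ℕ.+ b
∣k-m∣≤a+b t a b refl refl =
  subst (λ z → ∣ z ∣ ℕ.≤ a ℕ.+ b) (sym shared-cancels) (ℤP.∣i-j∣≤∣i∣+∣j∣ (+ a) (+ b))
  where
  cancel : ∀ t a b → (t + a) - (t + b) ≡ a - b
  cancel = solve-∀
  shared-cancels : + (t ℕ.+ a) - + (t ℕ.+ b) ≡ + a - + b
  shared-cancels = trans (cong₂ _-_ (ℤP.pos-+ t a) (ℤP.pos-+ t b)) (cancel (+ t) (+ a) (+ b))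

swap-middle : ∀ a b c d → (a - b) - (c - d) ≡ (a - c) - (b - d)
swap-middle = solve-∀

-- Of the partition and of pr only monotonicity, pr I ≤ I - 1 and the stability of
-- [pr I .. I - 1] are needed.
lemma4p12 : {Σ : Set} (_≟_ : DecidableEquality Σ) (n : ℕ) (X : Vec Σ (suc n))
    (E0 : List (ℤ × ℤ)) → ValidE0 X E0 →
    (p : ℤ → ℤ) → StablePartition n E0 p →
    (pr : ℤ → ℤ) → IsPred n E0 p pr →
    (I I' : ℤ) → I < I' →
    let J = pr I
        J' = pr I'
        s = singXc n E0 I I' ℕ.+ singYc n E0 J J'
    in (ed _≟_ (substr X I I') (substr X J J') ℕ.≤ s × s ℕ.≤ singc n E0 J I')
       × (∣ (I' - J') - (I - J) ∣ ≡ ∣ (I' - I) - (J' - J) ∣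
          × ∣ (I' - I) - (J' - J) ∣ ℕ.≤ s × s ℕ.≤ singc n E0 J I')
lemma4p12 _≟_ n X E0 valid _ _ pr (pr-mono , _ , pr≤ , pr-stable) I I' I<I' =
  (ed≤ , s≤sing) , (cong ∣_∣ (swap-middle I' (pr I') I (pr I)) , shift≤ , s≤sing)
  where
  open Alignment _≟_ (ext X) (ext X) (Edge n E0) (Edge-nonCrossing valid) (Edge-sameLetter valid)
         (Edge-matchˡ? n E0) (Edge-matchʳ? n E0) (singX? n E0) (singY? n E0)
  J = pr I
  J' = pr I'
  I≤I' = ℤP.<⇒≤ I<I'
  J≤J' = pr-mono I I' I≤I'
  open Aligned (aligned (len I I') (len J J') I J (stable-windows-closed I I' (pr-stable I) (pr-stable I')))
  s≤sing = ℕP.+-mono-≤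
    (count-interval-mono (singX? n E0) (ℤP.<⇒≤ (≤i-1⇒< I (pr≤ I))) I≤I' ℤP.≤-refl)
    (count-interval-mono (singY? n E0) ℤP.≤-refl J≤J' (ℤP.<⇒≤ (≤i-1⇒< I' (pr≤ I'))))
  shift≤ = subst (λ z → ∣ z ∣ ℕ.≤ singXc n E0 I I' ℕ.+ singYc n E0 J J')
    (cong₂ _-_ (+len≡ I≤I') (+len≡ J≤J'))
    (∣k-m∣≤a+b matched _ _ lengthˡ lengthʳ)
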